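{- Let $G$ be a graph and $(u,v)\in V_p$. If $r_w(u,v)=\frac{1}{|G|}$ for each $w\in V(G)$, then $d(u,v)$ is odd.
   Context: All graphs are finite, simple, connected and have at least two vertices; $d(x,y)$ is the shortest-path distance and $|G|$ the number of vertices. A vertex $w$ resolves $u,v$ if $d(u,w)\neq d(v,w)$. $V_p$ is the set of all unordered pairs of distinct vertices. For $(u,v)\in V_p$, $R(u,v)=\{x: x\text{ resolves } u,v\}$, and $r_w(u,v)=1/|R(u,v)|$ if $w$ resolves $u,v$, else $0$. -}

module Defs where

open import Data.Nat using (ℕ; zero; suc; _≤_; _<_)
open import Data.Bool using (Bool; true; false; _∧_; _∨_; if_then_else_; not)
open import Data.Fin using (Fin)
open import Data.Fin.Properties using () renaming (_≟_ to _≟ᶠ_)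
open import Data.List using (List; length; filter)
open import Data.Bool.ListAction using (any)
open import Data.List using () renaming (allFin to allFinL)
open import Data.Nat using () renaming (_≡ᵇ_ to _≡ℕ_)
open import Data.Integer using (+_)
open import Data.Rational using (ℚ; 0ℚ; _/_)
open import Data.Product using (Σ; _×_)
open import Relation.Binary.PropositionalEquality using (_≡_)
open import Relation.Nullary using (¬_; does)

record Graph : Set where
  field
    n      : ℕ
    adj    : Fin n → Fin n → Bool
    sym    : ∀ x y → adj x y ≡ adj y x
    irrefl : ∀ x → adj x x ≡ false
open Graph public

data Walk (G : Graph) : Fin (n G) → Fin (n G) → ℕ → Set where
  here : ∀ x → Walk G x x 0
  step : ∀ {x y z k} → adj G x y ≡ true → Walk G y z k → Walk G x z (suc k)

Connected : Graph → Set
Connected G = ∀ x y → Σ ℕ (λ k → Walk G x y k)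

order : Graph → ℕ
order G = n G

_==_ : ∀ {m} → Fin m → Fin m → Bool
x == y = does (x ≟ᶠ y)

-- reach G k x y = true iff there is a walk of length ≤ k from x to y.
reach : (G : Graph) → ℕ → Fin (n G) → Fin (n G) → Bool
reach G zero    x y = x == y
reach G (suc k) x y = reach G k x y ∨ any (λ z → reach G k x z ∧ adj G z y) (allFinL (n G))

-- Shortest-path distance: the least k with a walk of length ≤ k (i.e. the
-- length of a shortest walk); searched over k = 0 .. n G, which suffices in
-- a connected graph (default value n G never used then).
distFrom : (G : Graph) → ℕ → ℕ → Fin (n G) → Fin (n G) → ℕ
distFrom G k zero     x y = k
distFrom G k (suc f) x y = if reach G k x y then k else distFrom G (suc k) f x y

d : (G : Graph) → Fin (n G) → Fin (n G) → ℕ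
d G x y = distFrom G 0 (n G) x y

resolves : (G : Graph) → Fin (n G) → Fin (n G) → Fin (n G) → Bool
resolves G w u v = not (d G u w ≡ℕ d G v w)

Rsize : (G : Graph) → Fin (n G) → Fin (n G) → ℕ
Rsize G u v = length (filter (λ x → resolves G x u v ≟b true) (allFinL (n G)))
  where
  open import Data.Bool.Properties using () renaming (_≟_ to _≟b_)

-- the rational 1/k (for k = 0 the value is irrelevant and set to 0)
1/ℕ : ℕ → ℚ
1/ℕ zero    = 0ℚ
1/ℕ (suc m) = (+ 1) / suc m

r : (G : Graph) → Fin (n G) → Fin (n G) → Fin (n G) → ℚ
r G w u v = if resolves G w u v then 1/ℕ (Rsize G u v) else 0ℚ

module Submission where

-- If every vertex w has r_w(u,v) = 1/|G|, then in particular no vertex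
-- fails to resolve u and v (such a vertex would have r_w(u,v) = 0 ≠ 1/|G|).
-- But if d(u,v) = 2q were even, the middle vertex w of a shortest u–v walk
-- satisfies d(u,w) = q = d(v,w), so w does not resolve u and v.  Hence
-- d(u,v) is odd.

open import Defs
open import Data.Nat using (ℕ; zero; suc; _+_; _≤_; _<_; _%_; z≤n; s≤s)
open import Data.Nat.Properties
  using (≤-refl; ≤-trans; ≤-antisym; ≤-pred; ≤⇒≯; ≰⇒>; +-identityʳ; +-suc; +-cancelʳ-≤;
         m≤n⇒m≤1+n; m≤n⇒m<n∨m≡n; m≤n⇒∃[o]m+o≡n; ≡⇒≡ᵇ)
open import Data.Nat.Induction using (<-rec)
open import Data.Bool using (true; false; T; not; _∧_; if_then_else_)
open import Data.Bool.Properties using (T-∨; T-∧; T-≡; T?)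
open import Data.Fin using (Fin; toℕ)
open import Data.Fin.Properties using (toℕ-injective; toℕ<n; injective⇒≤) renaming (_≟_ to _≟ᶠ_)
open import Data.List using (allFin)
open import Data.List.Relation.Unary.Any using (satisfied)
open import Data.List.Relation.Unary.Any.Properties using (any⁺; any⁻)
open import Data.List.Membership.Propositional using (lose)
open import Data.List.Membership.Propositional.Properties using (∈-allFin)
open import Data.Product using (Σ; _×_; _,_; proj₁; proj₂)
open import Data.Sum using (_⊎_; inj₁; inj₂)
open import Data.Empty using (⊥-elim)
open import Data.Rational using (0ℚ; Positive)
open import Data.Rational.Properties using (normalize-pos)
open import Function.Bundles using (Equivalence)
open import Relation.Binary.PropositionalEquality using (_≡_; _≢_; refl; trans; cong; subst) renaming (sym to ≡-sym)
open import Relation.Nullary using (¬_; yes; no)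

open Equivalence using (to; from)

module Geodesics (G : Graph) where

  Vertex : Set
  Vertex = Fin (n G)

  private variable
    x y z : Vertex
    i k a b m : ℕ

  snoc : Walk G x y k → adj G y z ≡ true → Walk G x z (suc k)
  snoc (here _)   y~z = step y~z (here _)
  snoc (step e w) y~z = step e (snoc w y~z)

  unsnoc : Walk G x z (suc k) → Σ Vertex λ y → Walk G x y k × adj G y z ≡ true
  unsnoc (step e (here _))   = _ , here _ , e
  unsnoc (step e (step e′ w)) =
    let y , w′ , y~z = unsnoc (step e′ w) in y , step e w′ , y~z

  reverse : Walk G x y k → Walk G y x k
  reverse (here x)                   = here x
  reverse (step {x = x} {y = y} e w) = snoc (reverse w) (trans (Graph.sym G y x) e)

  _++ʷ_ : Walk G x y a → Walk G y z b → Walk G x z (a + b)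
  here _   ++ʷ w′ = w′
  step e w ++ʷ w′ = step e (w ++ʷ w′)

  splitAt : ∀ a → Walk G x z (a + b) → Σ Vertex λ y → Walk G x y a × Walk G y z b
  splitAt zero    w          = _ , here _ , w
  splitAt (suc a) (step e w) = let y , w₁ , w₂ = splitAt a w in y , step e w₁ , w₂

  ==-refl : (x : Vertex) → T (x == x)
  ==-refl x with x ≟ᶠ x
  ... | yes _  = _
  ... | no x≢x = x≢x refl

  ==-sound : T (x == y) → x ≡ y
  ==-sound {x} {y} t with x ≟ᶠ y
  ... | yes x≡y = x≡y

  reach-complete : ∀ k → i ≤ k → Walk G x y i → T (reach G k x y)
  reach-complete zero    z≤n (here x) = ==-refl x
  reach-complete (suc k) i≤1+k w with m≤n⇒m<n∨m≡n i≤1+k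
  ... | inj₁ i<1+k = from T-∨ (inj₁ (reach-complete k (≤-pred i<1+k) w))
  ... | inj₂ refl  =
    let y , w′ , y~z = unsnoc w
        lastStep     = from T-∧ (reach-complete k ≤-refl w′ , from T-≡ y~z)
    in from T-∨ (inj₂ (any⁺ _ (lose (∈-allFin y) lastStep)))

  reach-sound : ∀ {x y} k → T (reach G k x y) → Σ ℕ λ i → i ≤ k × Walk G x y i
  reach-sound {x} {y} zero t with ==-sound {x} {y} t
  ... | refl = 0 , z≤n , here x
  reach-sound {x} {y} (suc k) t with to T-∨ t
  ... | inj₁ t′ = let i , i≤k , w = reach-sound k t′ in i , m≤n⇒m≤1+n i≤k , w
  ... | inj₂ t′ =
    let v , t″      = satisfied (any⁻ (λ z → reach G k x z ∧ adj G z y) (allFin (n G)) t′)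
        x→v , v~y   = to T-∧ t″
        i , i≤k , w = reach-sound k x→v
    in suc i , s≤s i≤k , snoc w (to T-≡ v~y)

  Geodesic : Vertex → Vertex → ℕ → Set
  Geodesic x y m = Walk G x y m × (∀ {i} → Walk G x y i → m ≤ i)

  geodesic-unique : Geodesic x y a → Geodesic x y b → a ≡ b
  geodesic-unique (wa , min-a) (wb , min-b) = ≤-antisym (min-a wb) (min-b wa)

  geodesic-reverse : Geodesic x y m → Geodesic y x m
  geodesic-reverse (w , minimal) = reverse w , λ w′ → minimal (reverse w′)

  geodesic-prefix : Geodesic x z (a + b) → Walk G x y a → Walk G y z b → Geodesic x y a
  geodesic-prefix {b = b} (_ , minimal) w₁ w₂ =
    w₁ , λ {i} w → +-cancelʳ-≤ b _ i (minimal (w ++ʷ w₂))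

  -- Any walk can be shortened to a geodesic: while reach detects a strictly
  -- shorter walk, pass to it.
  shorten : Walk G x y k → Σ ℕ (Geodesic x y)
  shorten {x} {y} {k} = <-rec (λ k → Walk G x y k → Σ ℕ (Geodesic x y)) shorten′ k
    where
    shorten′ : ∀ k → (∀ {i} → i < k → Walk G x y i → Σ ℕ (Geodesic x y)) →
               Walk G x y k → Σ ℕ (Geodesic x y)
    shorten′ zero    _       w = 0 , w , λ _ → z≤n
    shorten′ (suc k) shorter w with T? (reach G k x y)
    ... | yes t = let i , i≤k , w′ = reach-sound k t in shorter (s≤s i≤k) w′
    ... | no ¬t = suc k , w , λ w′ → ≰⇒> (λ i≤k → ¬t (reach-complete k i≤k w′))

  geodesic-exists : Connected G → ∀ x y → Σ ℕ (Geodesic x y)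
  geodesic-exists connected x y = shorten (proj₂ (connected x y))

  waypoint : Geodesic x z m → (p : Fin (suc m)) → Σ Vertex λ y → Geodesic x y (toℕ p)
  waypoint {x} {z} γ p =
    let _ , p+o≡m   = m≤n⇒∃[o]m+o≡n (≤-pred (toℕ<n p))
        γ′          = subst (Geodesic x z) (≡-sym p+o≡m) γ
        y , w₁ , w₂ = splitAt (toℕ p) (proj₁ γ′)
    in y , geodesic-prefix γ′ w₁ w₂

  -- The m + 1 waypoints of a geodesic of length m are pairwise distinct
  -- (they lie at distinct distances from the start), so m < |G|.
  geodesic-short : Geodesic x z m → m < n G
  geodesic-short {x} γ = injective⇒≤ {f = λ p → proj₁ (waypoint γ p)} waypoints-distinct
    where
    waypoints-distinct : ∀ {p q} → proj₁ (waypoint γ p) ≡ proj₁ (waypoint γ q) → p ≡ q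
    waypoints-distinct {p} {q} same = toℕ-injective (geodesic-unique γp γq)
      where
      γp = proj₂ (waypoint γ p)
      γq = subst (λ y → Geodesic x y (toℕ q)) (≡-sym same) (proj₂ (waypoint γ q))

  reach-geodesic : Geodesic x y m → T (reach G k x y) → m ≤ k
  reach-geodesic {k = k} (_ , minimal) t =
    let i , i≤k , w = reach-sound k t in ≤-trans (minimal w) i≤k

  distFrom-geodesic : Geodesic x y m → ∀ k f → k ≤ m → m < k + f → distFrom G k f x y ≡ m
  distFrom-geodesic {m = m} γ k zero k≤m m<k+0 =
    ⊥-elim (≤⇒≯ k≤m (subst (m <_) (+-identityʳ k) m<k+0))
  distFrom-geodesic {x} {y} {m} γ k (suc f) k≤m m<k+f with reach G k x y in found
  ... | true  = ≤-antisym k≤m (reach-geodesic γ (subst T (≡-sym found) _))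
  ... | false with m≤n⇒m<n∨m≡n k≤m
  ...   | inj₁ k<m = distFrom-geodesic γ (suc k) f k<m (subst (m <_) (+-suc k f) m<k+f)
  ...   | inj₂ refl = ⊥-elim (subst T found (reach-complete k ≤-refl (proj₁ γ)))

  -- The distance of Defs is the length of any geodesic (fuel |G| suffices
  -- because geodesics are short).
  d-geodesic : Geodesic x y m → d G x y ≡ m
  d-geodesic γ = distFrom-geodesic γ 0 (n G) z≤n (geodesic-short γ)

  even-geodesic-midpoint : ∀ {u v q} → Geodesic u v (q + q) →
                           Σ Vertex λ w → d G u w ≡ q × d G v w ≡ q
  even-geodesic-midpoint {q = q} γ =
    let w , w₁ , w₂ = splitAt q (proj₁ γ)
    in w , d-geodesic (geodesic-prefix γ w₁ w₂)
         , d-geodesic (geodesic-prefix (geodesic-reverse γ) (reverse w₂) (reverse w₁))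

equidistant-r-zero : (G : Graph) {u v w : Fin (n G)} → d G u w ≡ d G v w → r G w u v ≡ 0ℚ
equidistant-r-zero G {u} {v} {w} same-distance =
  cong (λ b → if b then 1/ℕ (Rsize G u v) else 0ℚ) not-resolving
  where
  not-resolving : resolves G w u v ≡ false
  not-resolving = cong not (to T-≡ (≡⇒≡ᵇ _ _ same-distance))

1/ℕ-nonzero : ∀ {N} → 0 < N → 1/ℕ N ≢ 0ℚ
1/ℕ-nonzero {suc m} _ 1/N≡0 = 0ℚ-not-positive (subst Positive 1/N≡0 (normalize-pos 1 (suc m)))
  where
  0ℚ-not-positive : ¬ Positive 0ℚ
  0ℚ-not-positive ()

even-or-odd : ∀ m → Σ ℕ (λ q → m ≡ q + q) ⊎ m % 2 ≡ 1
even-or-odd zero          = inj₁ (0 , refl)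
even-or-odd (suc zero)    = inj₂ refl
even-or-odd (suc (suc m)) with even-or-odd m
... | inj₁ (q , refl) = inj₁ (suc q , cong suc (≡-sym (+-suc q q)))
... | inj₂ odd        = inj₂ odd

lemma2p11 : (G : Graph) → Connected G → 2 ≤ order G →
            (u v : Fin (n G)) → ¬ (u ≡ v) →
            ((w : Fin (n G)) → r G w u v ≡ 1/ℕ (order G)) →
            d G u v % 2 ≡ 1
lemma2p11 G connected 2≤|G| u v _ r≡1/|G| = odd-geodesic (geodesic-exists connected u v)
  where
  open Geodesics G

  -- An even geodesic length is impossible: its midpoint w would have
  -- r_w(u,v) = 0, whereas r_w(u,v) = 1/|G| ≠ 0 by hypothesis.
  odd-geodesic : Σ ℕ (Geodesic u v) → d G u v % 2 ≡ 1
  odd-geodesic (m , γ) with even-or-odd m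
  ... | inj₂ m-odd      = trans (cong (_% 2) (d-geodesic γ)) m-odd
  ... | inj₁ (q , refl) =
    let w , d[u,w]≡q , d[v,w]≡q = even-geodesic-midpoint {q = q} γ
        r[w]≡0 = equidistant-r-zero G (trans d[u,w]≡q (≡-sym d[v,w]≡q))
    in ⊥-elim (1/ℕ-nonzero (≤-trans (s≤s z≤n) 2≤|G|) (trans (≡-sym (r≡1/|G| w)) r[w]≡0))
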